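{- Let $A$ be a subdirectly irreducible MV-monoidal algebra. Then for all $x,y\in A$, either $x\oplus y=1$ or $x\odot y=0$.
   Context: An MV-monoidal algebra is an algebra $\langle A;\oplus,\odot,\vee,\wedge,0,1\rangle$ (arities $2,2,2,2,0,0$) satisfying: $\langle A;\vee,\wedge\rangle$ is a distributive lattice; $\langle A;\oplus,0\rangle$ and $\langle A;\odot,1\rangle$ are commutative monoids; $\oplus$ and $\odot$ both distribute over both $\vee$ and $\wedge$; $(x\oplus y)\odot((x\odot y)\oplus z)=(x\odot(y\oplus z))\oplus(y\odot z)$; $(x\odot y)\oplus((x\oplus y)\odot z)=(x\oplus(y\odot z))\odot(y\oplus z)$; $(x\odot y)\oplus z=((x\oplus y)\odot((x\odot y)\oplus z))\vee z$; $(x\oplus y)\odot z=((x\odot y)\oplus((x\oplus y)\odot z))\wedge z$. Subdirect irreducibility is in the sense of universal algebra for this signature. -}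

module Defs where

open import Level using (Level; _⊔_; suc)
open import Relation.Binary.Core using (Rel)
open import Relation.Binary.Structures using (IsEquivalence)
open import Relation.Nullary using (¬_)
open import Data.Product using (Σ; ∃; ∃-syntax; _×_; _,_)

record MVMonoidal (a ℓ : Level) : Set (suc (a ⊔ ℓ)) where
  infixl 6 _⊕_
  infixl 7 _⊙_
  infixl 5 _∨_
  infixl 5 _∧_
  infix 4 _≈_
  field
    Carrier : Set a
    _≈_     : Rel Carrier ℓ
    _⊕_ _⊙_ _∨_ _∧_ : Carrier → Carrier → Carrier
    𝟘 𝟙     : Carrier
    isEquivalence : IsEquivalence _≈_
    ⊕-cong : ∀ {x x' y y'} → x ≈ x' → y ≈ y' → x ⊕ y ≈ x' ⊕ y'
    ⊙-cong : ∀ {x x' y y'} → x ≈ x' → y ≈ y' → x ⊙ y ≈ x' ⊙ y'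
    ∨-cong : ∀ {x x' y y'} → x ≈ x' → y ≈ y' → x ∨ y ≈ x' ∨ y'
    ∧-cong : ∀ {x x' y y'} → x ≈ x' → y ≈ y' → x ∧ y ≈ x' ∧ y'
    ∨-comm  : ∀ x y → x ∨ y ≈ y ∨ x
    ∧-comm  : ∀ x y → x ∧ y ≈ y ∧ x
    ∨-assoc : ∀ x y z → (x ∨ y) ∨ z ≈ x ∨ (y ∨ z)
    ∧-assoc : ∀ x y z → (x ∧ y) ∧ z ≈ x ∧ (y ∧ z)
    ∨-absorbs-∧ : ∀ x y → x ∨ (x ∧ y) ≈ x
    ∧-absorbs-∨ : ∀ x y → x ∧ (x ∨ y) ≈ x
    ∧-distrib-∨ : ∀ x y z → x ∧ (y ∨ z) ≈ (x ∧ y) ∨ (x ∧ z)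
    ⊕-comm  : ∀ x y → x ⊕ y ≈ y ⊕ x
    ⊕-assoc : ∀ x y z → (x ⊕ y) ⊕ z ≈ x ⊕ (y ⊕ z)
    ⊕-identity : ∀ x → x ⊕ 𝟘 ≈ x
    ⊙-comm  : ∀ x y → x ⊙ y ≈ y ⊙ x
    ⊙-assoc : ∀ x y z → (x ⊙ y) ⊙ z ≈ x ⊙ (y ⊙ z)
    ⊙-identity : ∀ x → x ⊙ 𝟙 ≈ x
    ⊕-distrib-∨ : ∀ x y z → x ⊕ (y ∨ z) ≈ (x ⊕ y) ∨ (x ⊕ z)
    ⊕-distrib-∧ : ∀ x y z → x ⊕ (y ∧ z) ≈ (x ⊕ y) ∧ (x ⊕ z)
    ⊙-distrib-∨ : ∀ x y z → x ⊙ (y ∨ z) ≈ (x ⊙ y) ∨ (x ⊙ z)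
    ⊙-distrib-∧ : ∀ x y z → x ⊙ (y ∧ z) ≈ (x ⊙ y) ∧ (x ⊙ z)
    mv₁ : ∀ x y z → (x ⊕ y) ⊙ ((x ⊙ y) ⊕ z) ≈ (x ⊙ (y ⊕ z)) ⊕ (y ⊙ z)
    mv₂ : ∀ x y z → (x ⊙ y) ⊕ ((x ⊕ y) ⊙ z) ≈ (x ⊕ (y ⊙ z)) ⊙ (y ⊕ z)
    mv₃ : ∀ x y z → (x ⊙ y) ⊕ z ≈ ((x ⊕ y) ⊙ ((x ⊙ y) ⊕ z)) ∨ z
    mv₄ : ∀ x y z → (x ⊕ y) ⊙ z ≈ ((x ⊙ y) ⊕ ((x ⊕ y) ⊙ z)) ∧ z

record IsHom {a₁ ℓ₁ a₂ ℓ₂ : Level} (A : MVMonoidal a₁ ℓ₁) (B : MVMonoidal a₂ ℓ₂)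
             (h : MVMonoidal.Carrier A → MVMonoidal.Carrier B) : Set (a₁ ⊔ ℓ₁ ⊔ ℓ₂) where
  private
    module A = MVMonoidal A
    module B = MVMonoidal B
  field
    cong  : ∀ {x y} → x A.≈ y → h x B.≈ h y
    hom-⊕ : ∀ x y → h (x A.⊕ y) B.≈ h x B.⊕ h y
    hom-⊙ : ∀ x y → h (x A.⊙ y) B.≈ h x B.⊙ h y
    hom-∨ : ∀ x y → h (x A.∨ y) B.≈ h x B.∨ h y
    hom-∧ : ∀ x y → h (x A.∧ y) B.≈ h x B.∧ h y
    hom-𝟘 : h A.𝟘 B.≈ B.𝟘
    hom-𝟙 : h A.𝟙 B.≈ B.𝟙

module _ {a₁ ℓ₁ a₂ ℓ₂ : Level} (A : MVMonoidal a₁ ℓ₁) (B : MVMonoidal a₂ ℓ₂) where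
  private
    module A = MVMonoidal A
    module B = MVMonoidal B

  Injective : (A.Carrier → B.Carrier) → Set (a₁ ⊔ ℓ₁ ⊔ ℓ₂)
  Injective h = ∀ x y → h x B.≈ h y → x A.≈ y

  Surjective : (A.Carrier → B.Carrier) → Set (a₁ ⊔ a₂ ⊔ ℓ₂)
  Surjective h = ∀ b → ∃[ x ] (h x B.≈ b)

-- A family of homomorphisms hᵢ : A → Bᵢ (i ∈ I) is a subdirect embedding
-- A ↪ Πᵢ Bᵢ when the induced map into the product is injective (jointly
-- injective: hᵢ x ≈ hᵢ y for all i implies x ≈ y) and every projection
-- πᵢ ∘ h = hᵢ is surjective.
record IsSubdirectEmbedding {a ℓ : Level} (A : MVMonoidal a ℓ) (I : Set (suc (a ⊔ ℓ)))
       (B : I → MVMonoidal a ℓ)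
       (h : (i : I) → MVMonoidal.Carrier A → MVMonoidal.Carrier (B i))
       : Set (suc (a ⊔ ℓ)) where
  private
    module A = MVMonoidal A
  field
    homs       : ∀ i → IsHom A (B i) (h i)
    jointlyInj : ∀ x y → (∀ i → MVMonoidal._≈_ (B i) (h i x) (h i y)) → x A.≈ y
    surj       : ∀ i → Surjective A (B i) (h i)

-- Subdirectly irreducible (Birkhoff / Burris–Sankappanavar Def. 8.1):
-- A is nontrivial, and for every subdirect embedding A ↪ Πᵢ Bᵢ some
-- projection πᵢ ∘ h is an isomorphism (it is already a surjective
-- homomorphism, so it suffices that it be injective).
record SubdirectlyIrreducible {a ℓ : Level} (A : MVMonoidal a ℓ) : Set (suc (suc (a ⊔ ℓ))) where
  private
    module A = MVMonoidal A
  field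
    nontrivial : ∃[ x ] ∃[ y ] (¬ (x A.≈ y))
    irreducible : (I : Set (suc (a ⊔ ℓ))) (B : I → MVMonoidal a ℓ)
                  (h : (i : I) → A.Carrier → MVMonoidal.Carrier (B i)) →
                  IsSubdirectEmbedding A I B h →
                  ∃[ i ] Injective A (B i) (h i)

module Submission where

-- For c ∈ A, let Θ₀ c relate u and v when each lies below n·c ⊕ the other for
-- some n: a congruence identifying c with 𝟘.  Dually Θ₁ c identifies c with 𝟙.
-- The identities mv₃ and mv₄ show that u ≤ (x ⊙ y) ⊕ v together with
-- (x ⊕ y) ⊙ u ≤ v forces u ≤ v, and this survives replacing x ⊙ y by its
-- multiples and x ⊕ y by its powers, so Θ₀ (x ⊙ y) and Θ₁ (x ⊕ y) meet in the
-- identity.  In a subdirectly irreducible algebra one of two such congruences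
-- is the identity, i.e. x ⊙ y ≈ 𝟘 or x ⊕ y ≈ 𝟙.

open import Defs
open import Level using (Level; Lift; lift; _⊔_) renaming (suc to lsuc)
open import Algebra.Core using (Op₂)
import Algebra.Definitions as AlgDefs
import Algebra.Lattice.Bundles as Alg
open import Algebra.Lattice.Properties.Lattice using (∨-∧-orderTheoreticLattice)
open import Data.Bool using (Bool; true; false)
open import Data.Nat using (ℕ; zero; suc; _+_)
open import Data.Nat.Properties using (+-comm)
open import Data.Product using (∃-syntax; _×_; _,_)
open import Data.Sum using (_⊎_; inj₁; inj₂; map; swap)
open import Relation.Binary.Core using (Rel; _⇒_; _Preserves₂_⟶_⟶_)
open import Relation.Binary.Bundles using (Setoid)
open import Relation.Binary.Structures using (IsEquivalence)
open import Relation.Binary.Lattice using (DistributiveLattice; Lattice)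
import Relation.Binary.Lattice.Properties.DistributiveLattice as DistributiveLatticeProperties
import Relation.Binary.Lattice.Properties.JoinSemilattice as JoinSemilatticeProperties
import Relation.Binary.Lattice.Properties.MeetSemilattice as MeetSemilatticeProperties
import Relation.Binary.Reasoning.PartialOrder as ≤-Reasoning
import Relation.Binary.Reasoning.Setoid as SetoidReasoning
open import Relation.Binary.PropositionalEquality using (subst)

module LatticeOrder {a ℓ : Level} (A : MVMonoidal a ℓ) where
  open MVMonoidal A

  algebraicLattice : Alg.Lattice a ℓ
  algebraicLattice = record
    { isLattice = record
      { isEquivalence = isEquivalence
      ; ∨-comm = ∨-comm ; ∨-assoc = ∨-assoc ; ∨-cong = ∨-cong
      ; ∧-comm = ∧-comm ; ∧-assoc = ∧-assoc ; ∧-cong = ∧-cong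
      ; absorptive = ∨-absorbs-∧ , ∧-absorbs-∨
      }
    }

  distributiveLattice : DistributiveLattice a ℓ ℓ
  distributiveLattice = record
    { isDistributiveLattice = record
      { isLattice = Lattice.isLattice (∨-∧-orderTheoreticLattice algebraicLattice)
      ; ∧-distribˡ-∨ = ∧-distrib-∨
      }
    }

  open DistributiveLattice distributiveLattice public
    using (_≤_; poset; refl; reflexive; trans; antisym; ≤-respˡ-≈; ≤-respʳ-≈
          ; x≤x∨y; y≤x∨y; ∨-least; x∧y≤y; ∧-greatest)
  open DistributiveLatticeProperties distributiveLattice public using (∨-distribˡ-∧)
  open JoinSemilatticeProperties (DistributiveLattice.joinSemilattice distributiveLattice) public
    using (∨-monotonic)
  open MeetSemilatticeProperties (DistributiveLattice.meetSemilattice distributiveLattice) public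
    using (∧-monotonic)
  open IsEquivalence isEquivalence using () renaming (refl to ≈-refl; trans to ≈-trans)
  open ≤-Reasoning poset

  ⊕-identityˡ : ∀ x → 𝟘 ⊕ x ≈ x
  ⊕-identityˡ x = ≈-trans (⊕-comm 𝟘 x) (⊕-identity x)

  ⊙-identityˡ : ∀ x → 𝟙 ⊙ x ≈ x
  ⊙-identityˡ x = ≈-trans (⊙-comm 𝟙 x) (⊙-identity x)

  distribˡ-∧⇒monotonic : ∀ {_∙_ : Op₂ Carrier} → AlgDefs.Congruent₂ _≈_ _∙_ →
                         AlgDefs.Commutative _≈_ _∙_ → AlgDefs._DistributesOverˡ_ _≈_ _∙_ _∧_ →
                         _∙_ Preserves₂ _≤_ ⟶ _≤_ ⟶ _≤_
  distribˡ-∧⇒monotonic {_∙_} cong comm distrib {x} {x'} {y} {y'} x≤x' y≤y' = begin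
    x ∙ y    ≤⟨ monoʳ x y≤y' ⟩
    x ∙ y'   ≈⟨ comm x y' ⟩
    y' ∙ x   ≤⟨ monoʳ y' x≤x' ⟩
    y' ∙ x'  ≈⟨ comm y' x' ⟩
    x' ∙ y'  ∎
    where
    monoʳ : ∀ w {u v} → u ≤ v → w ∙ u ≤ w ∙ v
    monoʳ w {u} {v} u≤v = ≈-trans (cong ≈-refl u≤v) (distrib w u v)

  ⊕-monotonic : _⊕_ Preserves₂ _≤_ ⟶ _≤_ ⟶ _≤_
  ⊕-monotonic = distribˡ-∧⇒monotonic ⊕-cong ⊕-comm ⊕-distrib-∧

  ⊙-monotonic : _⊙_ Preserves₂ _≤_ ⟶ _≤_ ⟶ _≤_
  ⊙-monotonic = distribˡ-∧⇒monotonic ⊙-cong ⊙-comm ⊙-distrib-∧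

  𝟘-least : ∀ x → 𝟘 ≤ x
  𝟘-least x = begin
    𝟘                                      ≤⟨ y≤x∨y _ 𝟘 ⟩
    ((𝟙 ⊕ x) ⊙ ((𝟙 ⊙ x) ⊕ 𝟘)) ∨ 𝟘        ≈⟨ mv₃ 𝟙 x 𝟘 ⟨
    (𝟙 ⊙ x) ⊕ 𝟘                            ≈⟨ ⊕-identity (𝟙 ⊙ x) ⟩
    𝟙 ⊙ x                                  ≈⟨ ⊙-identityˡ x ⟩
    x                                      ∎

  x≤y⊕x : ∀ x y → x ≤ y ⊕ x
  x≤y⊕x x y = begin
    x      ≈⟨ ⊕-identityˡ x ⟨
    𝟘 ⊕ x  ≤⟨ ⊕-monotonic (𝟘-least y) refl ⟩
    y ⊕ x  ∎

dual : ∀ {a ℓ} → MVMonoidal a ℓ → MVMonoidal a ℓ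
dual A = record
  { Carrier = Carrier ; _≈_ = _≈_ ; _⊕_ = _⊙_ ; _⊙_ = _⊕_ ; _∨_ = _∧_ ; _∧_ = _∨_
  ; 𝟘 = 𝟙 ; 𝟙 = 𝟘 ; isEquivalence = isEquivalence
  ; ⊕-cong = ⊙-cong ; ⊙-cong = ⊕-cong ; ∨-cong = ∧-cong ; ∧-cong = ∨-cong
  ; ∨-comm = ∧-comm ; ∧-comm = ∨-comm ; ∨-assoc = ∧-assoc ; ∧-assoc = ∨-assoc
  ; ∨-absorbs-∧ = ∧-absorbs-∨ ; ∧-absorbs-∨ = ∨-absorbs-∧ ; ∧-distrib-∨ = ∨-distribˡ-∧
  ; ⊕-comm = ⊙-comm ; ⊕-assoc = ⊙-assoc ; ⊕-identity = ⊙-identity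
  ; ⊙-comm = ⊕-comm ; ⊙-assoc = ⊕-assoc ; ⊙-identity = ⊕-identity
  ; ⊕-distrib-∨ = ⊙-distrib-∧ ; ⊕-distrib-∧ = ⊙-distrib-∨
  ; ⊙-distrib-∨ = ⊕-distrib-∧ ; ⊙-distrib-∧ = ⊕-distrib-∨
  ; mv₁ = mv₂ ; mv₂ = mv₁ ; mv₃ = mv₄ ; mv₄ = mv₃
  }
  where
  open MVMonoidal A
  open LatticeOrder A using (∨-distribˡ-∧)

module Properties {a ℓ : Level} (A : MVMonoidal a ℓ) where
  open MVMonoidal A
  open IsEquivalence isEquivalence using () renaming (refl to ≈-refl; sym to ≈-sym; trans to ≈-trans)
  open LatticeOrder A public
  open ≤-Reasoning poset
  private module Dual = LatticeOrder (dual A)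

  dual-≤⇒≥ : ∀ {x y} → Dual._≤_ x y → y ≤ x
  dual-≤⇒≥ {x} {y} x≈x∨y = ≤-respʳ-≈ (≈-sym x≈x∨y) (y≤x∨y x y)

  x⊙y≤y : ∀ x y → x ⊙ y ≤ y
  x⊙y≤y x y = dual-≤⇒≥ (Dual.x≤y⊕x y x)

  x⊙[y⊕z]≤y⊕x⊙z : ∀ x y z → x ⊙ (y ⊕ z) ≤ y ⊕ x ⊙ z
  x⊙[y⊕z]≤y⊕x⊙z x y z = begin
    x ⊙ (y ⊕ z)                ≈⟨ ⊙-comm x (y ⊕ z) ⟩
    (y ⊕ z) ⊙ x                ≤⟨ x≤y⊕x _ (y ⊙ z) ⟩
    y ⊙ z ⊕ (y ⊕ z) ⊙ x        ≈⟨ mv₂ y z x ⟩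
    (y ⊕ z ⊙ x) ⊙ (z ⊕ x)      ≈⟨ ⊙-comm _ _ ⟩
    (z ⊕ x) ⊙ (y ⊕ z ⊙ x)      ≤⟨ x⊙y≤y _ _ ⟩
    y ⊕ z ⊙ x                  ≈⟨ ⊕-cong ≈-refl (⊙-comm z x) ⟩
    y ⊕ x ⊙ z                  ∎

  -- u ≤ d ⊕ v says that u exceeds v by at most d; every operation keeps
  -- that bound.
  Shifts : Op₂ Carrier → Set (a ⊔ ℓ)
  Shifts _∙_ = ∀ {u v d} w → u ≤ d ⊕ v → w ∙ u ≤ d ⊕ w ∙ v

  ⊕-shifts : Shifts _⊕_
  ⊕-shifts {u} {v} {d} w u≤d⊕v = begin
    w ⊕ u        ≤⟨ ⊕-monotonic refl u≤d⊕v ⟩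
    w ⊕ (d ⊕ v)  ≈⟨ ⊕-assoc w d v ⟨
    w ⊕ d ⊕ v    ≈⟨ ⊕-cong (⊕-comm w d) ≈-refl ⟩
    d ⊕ w ⊕ v    ≈⟨ ⊕-assoc d w v ⟩
    d ⊕ (w ⊕ v)  ∎

  ⊙-shifts : Shifts _⊙_
  ⊙-shifts {u} {v} {d} w u≤d⊕v = begin
    w ⊙ u        ≤⟨ ⊙-monotonic refl u≤d⊕v ⟩
    w ⊙ (d ⊕ v)  ≤⟨ x⊙[y⊕z]≤y⊕x⊙z w d v ⟩
    d ⊕ w ⊙ v    ∎

  ∨-shifts : Shifts _∨_
  ∨-shifts {u} {v} {d} w u≤d⊕v = begin
    w ∨ u              ≤⟨ ∨-monotonic (x≤y⊕x w d) u≤d⊕v ⟩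
    (d ⊕ w) ∨ (d ⊕ v)  ≈⟨ ⊕-distrib-∨ d w v ⟨
    d ⊕ (w ∨ v)        ∎

  ∧-shifts : Shifts _∧_
  ∧-shifts {u} {v} {d} w u≤d⊕v = begin
    w ∧ u              ≤⟨ ∧-monotonic (x≤y⊕x w d) u≤d⊕v ⟩
    (d ⊕ w) ∧ (d ⊕ v)  ≈⟨ ⊕-distrib-∧ d w v ⟨
    d ⊕ (w ∧ v)        ∎

  infixr 8 _·_
  _·_ : ℕ → Carrier → Carrier
  zero  · x = 𝟘
  suc n · x = x ⊕ n · x

  ·-distribʳ-+ : ∀ m n x → (m + n) · x ≈ m · x ⊕ n · x
  ·-distribʳ-+ zero    n x = ≈-sym (⊕-identityˡ (n · x))
  ·-distribʳ-+ (suc m) n x =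
    ≈-trans (⊕-cong ≈-refl (·-distribʳ-+ m n x)) (≈-sym (⊕-assoc x (m · x) (n · x)))

record Congruence {a ℓ : Level} (A : MVMonoidal a ℓ) : Set (a ⊔ lsuc ℓ) where
  open MVMonoidal A using (Carrier; _≈_; _⊕_; _⊙_; _∨_; _∧_)
  infix 4 _∼_
  field
    _∼_           : Rel Carrier ℓ
    isEquivalence : IsEquivalence _∼_
    reflexive     : _≈_ ⇒ _∼_
    ⊕-cong        : AlgDefs.Congruent₂ _∼_ _⊕_
    ⊙-cong        : AlgDefs.Congruent₂ _∼_ _⊙_
    ∨-cong        : AlgDefs.Congruent₂ _∼_ _∨_
    ∧-cong        : AlgDefs.Congruent₂ _∼_ _∧_

dualCongruence : ∀ {a ℓ} {A : MVMonoidal a ℓ} → Congruence (dual A) → Congruence A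
dualCongruence θ = record
  { _∼_ = _∼_ ; isEquivalence = isEquivalence ; reflexive = reflexive
  ; ⊕-cong = ⊙-cong ; ⊙-cong = ⊕-cong ; ∨-cong = ∧-cong ; ∧-cong = ∨-cong
  }
  where open Congruence θ

infixl 5 _/_
_/_ : ∀ {a ℓ} (A : MVMonoidal a ℓ) → Congruence A → MVMonoidal a ℓ
A / θ = record
  { Carrier = Carrier ; _≈_ = θ._∼_ ; _⊕_ = _⊕_ ; _⊙_ = _⊙_ ; _∨_ = _∨_ ; _∧_ = _∧_
  ; 𝟘 = 𝟘 ; 𝟙 = 𝟙 ; isEquivalence = θ.isEquivalence
  ; ⊕-cong = θ.⊕-cong ; ⊙-cong = θ.⊙-cong ; ∨-cong = θ.∨-cong ; ∧-cong = θ.∧-cong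
  ; ∨-comm = λ x y → θ.reflexive (∨-comm x y) ; ∧-comm = λ x y → θ.reflexive (∧-comm x y)
  ; ∨-assoc = λ x y z → θ.reflexive (∨-assoc x y z) ; ∧-assoc = λ x y z → θ.reflexive (∧-assoc x y z)
  ; ∨-absorbs-∧ = λ x y → θ.reflexive (∨-absorbs-∧ x y)
  ; ∧-absorbs-∨ = λ x y → θ.reflexive (∧-absorbs-∨ x y)
  ; ∧-distrib-∨ = λ x y z → θ.reflexive (∧-distrib-∨ x y z)
  ; ⊕-comm = λ x y → θ.reflexive (⊕-comm x y) ; ⊕-assoc = λ x y z → θ.reflexive (⊕-assoc x y z)
  ; ⊕-identity = λ x → θ.reflexive (⊕-identity x)
  ; ⊙-comm = λ x y → θ.reflexive (⊙-comm x y) ; ⊙-assoc = λ x y z → θ.reflexive (⊙-assoc x y z)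
  ; ⊙-identity = λ x → θ.reflexive (⊙-identity x)
  ; ⊕-distrib-∨ = λ x y z → θ.reflexive (⊕-distrib-∨ x y z)
  ; ⊕-distrib-∧ = λ x y z → θ.reflexive (⊕-distrib-∧ x y z)
  ; ⊙-distrib-∨ = λ x y z → θ.reflexive (⊙-distrib-∨ x y z)
  ; ⊙-distrib-∧ = λ x y z → θ.reflexive (⊙-distrib-∧ x y z)
  ; mv₁ = λ x y z → θ.reflexive (mv₁ x y z) ; mv₂ = λ x y z → θ.reflexive (mv₂ x y z)
  ; mv₃ = λ x y z → θ.reflexive (mv₃ x y z) ; mv₄ = λ x y z → θ.reflexive (mv₄ x y z)
  }
  where
  open MVMonoidal A
  module θ = Congruence θ

module _ {a ℓ : Level} {A : MVMonoidal a ℓ} where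
  open MVMonoidal A using (_≈_)

  projection-isHom : (θ : Congruence A) → IsHom A (A / θ) (λ x → x)
  projection-isHom θ = record
    { cong = reflexive
    ; hom-⊕ = λ _ _ → ∼-refl ; hom-⊙ = λ _ _ → ∼-refl
    ; hom-∨ = λ _ _ → ∼-refl ; hom-∧ = λ _ _ → ∼-refl
    ; hom-𝟘 = ∼-refl ; hom-𝟙 = ∼-refl
    }
    where
    open Congruence θ
    open IsEquivalence isEquivalence using () renaming (refl to ∼-refl)

  projection-surjective : (θ : Congruence A) → Surjective A (A / θ) (λ x → x)
  projection-surjective θ x = x , IsEquivalence.refl (Congruence.isEquivalence θ)

  IsTrivial : Congruence A → Set (a ⊔ ℓ)
  IsTrivial θ = ∀ x y → Congruence._∼_ θ x y → x ≈ y

  Disjoint : Congruence A → Congruence A → Set (a ⊔ ℓ)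
  Disjoint θ₁ θ₂ = ∀ x y → Congruence._∼_ θ₁ x y → Congruence._∼_ θ₂ x y → x ≈ y

  disjoint⇒trivial : SubdirectlyIrreducible A → ∀ θ₁ θ₂ → Disjoint θ₁ θ₂ →
                     IsTrivial θ₁ ⊎ IsTrivial θ₂
  disjoint⇒trivial si θ₁ θ₂ disjoint =
    pick (SubdirectlyIrreducible.irreducible si I (λ i → A / θ i) (λ _ x → x) embedding)
    where
    I : Set (lsuc (a ⊔ ℓ))
    I = Lift _ Bool
    θ : I → Congruence A
    θ (lift true)  = θ₁
    θ (lift false) = θ₂
    embedding : IsSubdirectEmbedding A I (λ i → A / θ i) (λ _ x → x)
    embedding = record
      { homs       = λ i → projection-isHom (θ i)
      ; jointlyInj = λ x y related → disjoint x y (related (lift true)) (related (lift false))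
      ; surj       = λ i → projection-surjective (θ i)
      }
    pick : ∃[ i ] Injective A (A / θ i) (λ x → x) → IsTrivial θ₁ ⊎ IsTrivial θ₂
    pick (lift true  , injective) = inj₁ injective
    pick (lift false , injective) = inj₂ injective

module PrincipalCongruence {a ℓ : Level} (A : MVMonoidal a ℓ) (c : MVMonoidal.Carrier A) where
  open MVMonoidal A
  open IsEquivalence isEquivalence using () renaming (refl to ≈-refl; sym to ≈-sym; trans to ≈-trans)
  open Properties A

  infix 4 _≋_
  _≋_ : Rel Carrier ℓ
  u ≋ v = ∃[ n ] (u ≤ n · c ⊕ v × v ≤ n · c ⊕ u)

  ≈⇒≤𝟘⊕ : ∀ {u v} → u ≈ v → u ≤ 𝟘 ⊕ v
  ≈⇒≤𝟘⊕ {u} {v} u≈v = reflexive (≈-trans u≈v (≈-sym (⊕-identityˡ v)))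

  ≤-·-trans : ∀ {u v w} m n → u ≤ m · c ⊕ v → v ≤ n · c ⊕ w → u ≤ (m + n) · c ⊕ w
  ≤-·-trans {u} {v} {w} m n u≤ v≤ = begin
    u                          ≤⟨ u≤ ⟩
    m · c ⊕ v                  ≤⟨ ⊕-monotonic refl v≤ ⟩
    m · c ⊕ (n · c ⊕ w)        ≈⟨ ⊕-assoc (m · c) (n · c) w ⟨
    m · c ⊕ n · c ⊕ w          ≈⟨ ⊕-cong (·-distribʳ-+ m n c) ≈-refl ⟨
    (m + n) · c ⊕ w            ∎
    where open ≤-Reasoning poset

  ≋-isEquivalence : IsEquivalence _≋_
  ≋-isEquivalence = record
    { refl  = 0 , ≈⇒≤𝟘⊕ ≈-refl , ≈⇒≤𝟘⊕ ≈-refl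
    ; sym   = λ (n , u≤ , v≤) → n , v≤ , u≤
    ; trans = λ { {u} {v} {w} (m , u≤ , v≤) (n , v≤′ , w≤) →
                  m + n , ≤-·-trans m n u≤ v≤′
                        , subst (λ k → w ≤ k · c ⊕ u) (+-comm n m) (≤-·-trans n m w≤ v≤) }
    }

  ≋-setoid : Setoid a ℓ
  ≋-setoid = record { isEquivalence = ≋-isEquivalence }

  ≈⇒≋ : _≈_ ⇒ _≋_
  ≈⇒≋ u≈v = 0 , ≈⇒≤𝟘⊕ u≈v , ≈⇒≤𝟘⊕ (≈-sym u≈v)

  shifts⇒congruent : ∀ {_∙_} → Shifts _∙_ → AlgDefs.Commutative _≈_ _∙_ → AlgDefs.Congruent₂ _≋_ _∙_
  shifts⇒congruent {_∙_} shifts comm {x} {x'} {y} {y'} x≋x' y≋y' = begin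
    x ∙ y    ≈⟨ congʳ x y≋y' ⟩
    x ∙ y'   ≈⟨ ≈⇒≋ (comm x y') ⟩
    y' ∙ x   ≈⟨ congʳ y' x≋x' ⟩
    y' ∙ x'  ≈⟨ ≈⇒≋ (comm y' x') ⟩
    x' ∙ y'  ∎
    where
    open SetoidReasoning ≋-setoid
    congʳ : ∀ w {u v} → u ≋ v → w ∙ u ≋ w ∙ v
    congʳ w (n , u≤ , v≤) = n , shifts w u≤ , shifts w v≤

  congruence : Congruence A
  congruence = record
    { _∼_ = _≋_ ; isEquivalence = ≋-isEquivalence ; reflexive = ≈⇒≋
    ; ⊕-cong = shifts⇒congruent ⊕-shifts ⊕-comm
    ; ⊙-cong = shifts⇒congruent ⊙-shifts ⊙-comm
    ; ∨-cong = shifts⇒congruent ∨-shifts ∨-comm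
    ; ∧-cong = shifts⇒congruent ∧-shifts ∧-comm
    }

  c≋𝟘 : c ≋ 𝟘
  c≋𝟘 = 1 , reflexive (≈-sym (≈-trans (⊕-identity (c ⊕ 𝟘)) (⊕-identity c))) , 𝟘-least _

Θ₀ Θ₁ : ∀ {a ℓ} (A : MVMonoidal a ℓ) → MVMonoidal.Carrier A → Congruence A
Θ₀ = PrincipalCongruence.congruence
Θ₁ A c = dualCongruence (Θ₀ (dual A) c)

Θ₀-identifies-𝟘 : ∀ {a ℓ} (A : MVMonoidal a ℓ) c → Congruence._∼_ (Θ₀ A c) c (MVMonoidal.𝟘 A)
Θ₀-identifies-𝟘 = PrincipalCongruence.c≋𝟘

Θ₁-identifies-𝟙 : ∀ {a ℓ} (A : MVMonoidal a ℓ) c → Congruence._∼_ (Θ₁ A c) c (MVMonoidal.𝟙 A)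
Θ₁-identifies-𝟙 A = Θ₀-identifies-𝟘 (dual A)

module Separation {a ℓ : Level} (A : MVMonoidal a ℓ) where
  open MVMonoidal A
  open IsEquivalence isEquivalence using () renaming (refl to ≈-refl; sym to ≈-sym; trans to ≈-trans)
  open Properties A
  open ≤-Reasoning poset
  private module Dual = Properties (dual A)

  Separating : Carrier → Carrier → Set (a ⊔ ℓ)
  Separating p b = ∀ {u v} → u ≤ p ⊕ v → b ⊙ u ≤ v → u ≤ v

  x⊙y-separating-x⊕y : ∀ x y → Separating (x ⊙ y) (x ⊕ y)
  x⊙y-separating-x⊕y x y {u} {v} u≤t⊕v s⊙u≤v = begin
    u                  ≤⟨ ∧-greatest (x≤x∨y u v) u≤t⊕v ⟩
    m ∧ (t ⊕ v)        ≤⟨ ∧-monotonic refl t⊕v≤T∨v ⟩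
    m ∧ (T ∨ v)        ≈⟨ ∧-distrib-∨ m T v ⟩
    (m ∧ T) ∨ (m ∧ v)  ≈⟨ ∨-cong (≈-trans (∧-comm m T) (≈-sym (mv₄ x y m))) ≈-refl ⟩
    s ⊙ m ∨ (m ∧ v)    ≤⟨ ∨-least s⊙m≤v (x∧y≤y m v) ⟩
    v                  ∎
    where
    t s m T : Carrier
    t = x ⊙ y
    s = x ⊕ y
    m = u ∨ v
    T = t ⊕ s ⊙ m

    t⊕v≤T∨v : t ⊕ v ≤ T ∨ v
    t⊕v≤T∨v = begin
      t ⊕ v            ≈⟨ mv₃ x y v ⟩
      s ⊙ (t ⊕ v) ∨ v  ≤⟨ ∨-monotonic (x⊙[y⊕z]≤y⊕x⊙z s t v) refl ⟩
      t ⊕ s ⊙ v ∨ v    ≤⟨ ∨-monotonic (⊕-monotonic refl (⊙-monotonic refl (y≤x∨y u v))) refl ⟩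
      T ∨ v            ∎

    s⊙m≤v : s ⊙ m ≤ v
    s⊙m≤v = begin
      s ⊙ (u ∨ v)      ≈⟨ ⊙-distrib-∨ s u v ⟩
      s ⊙ u ∨ s ⊙ v    ≤⟨ ∨-least s⊙u≤v (x⊙y≤y s v) ⟩
      v                ∎

  𝟘-separating : ∀ {b} → Separating 𝟘 b
  𝟘-separating {_} {u} {v} u≤𝟘⊕v _ = ≤-respʳ-≈ (⊕-identityˡ v) u≤𝟘⊕v

  𝟙-separating : ∀ {p} → Separating p 𝟙
  𝟙-separating {_} {u} {v} _ 𝟙⊙u≤v = ≤-respˡ-≈ (⊙-identityˡ u) 𝟙⊙u≤v

  ⊕-separating : ∀ {p p′ b} → Separating p b → Separating p′ b → Separating (p ⊕ p′) b
  ⊕-separating {p} {p′} {b} p-sep p′-sep {u} {v} u≤[p⊕p′]⊕v b⊙u≤v =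
    p′-sep (p-sep (≤-respʳ-≈ (⊕-assoc p p′ v) u≤[p⊕p′]⊕v)
                  (trans b⊙u≤v (x≤y⊕x v p′)))
           b⊙u≤v

  ⊙-separating : ∀ {p b b′} → Separating p b → Separating p b′ → Separating p (b ⊙ b′)
  ⊙-separating {p} {b} {b′} b-sep b′-sep {u} {v} u≤p⊕v bb′⊙u≤v =
    b′-sep u≤p⊕v (b-sep (trans (x⊙y≤y b′ u) u≤p⊕v)
                        (≤-respˡ-≈ (⊙-assoc b b′ u) bb′⊙u≤v))

  -- In the dual algebra n · b is the n-th ⊙-power of b.
  separating-powers : ∀ {p b} → Separating p b → ∀ n → Separating p (n Dual.· b)
  separating-powers sep zero    = 𝟙-separating
  separating-powers sep (suc n) = ⊙-separating sep (separating-powers sep n)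

  separating-multiples : ∀ {p b} → Separating p b → ∀ m n → Separating (m · p) (n Dual.· b)
  separating-multiples sep zero    n = 𝟘-separating
  separating-multiples sep (suc m) n =
    ⊕-separating (separating-powers sep n) (separating-multiples sep m n)

  Θ₀[x⊙y]-Θ₁[x⊕y]-disjoint : ∀ x y → Disjoint (Θ₀ A (x ⊙ y)) (Θ₁ A (x ⊕ y))
  Θ₀[x⊙y]-Θ₁[x⊕y]-disjoint x y u v (m , u≤ , v≤) (n , u≤ᵈ , v≤ᵈ) =
    antisym (sep u≤ (dual-≤⇒≥ v≤ᵈ)) (sep v≤ (dual-≤⇒≥ u≤ᵈ))
    where
    sep : Separating (m · (x ⊙ y)) (n Dual.· (x ⊕ y))
    sep = separating-multiples (x⊙y-separating-x⊕y x y) m n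

theoremC4 : {a ℓ : Level} (A : MVMonoidal a ℓ) → SubdirectlyIrreducible A →
            ∀ x y → MVMonoidal._≈_ A (MVMonoidal._⊕_ A x y) (MVMonoidal.𝟙 A)
                    ⊎ MVMonoidal._≈_ A (MVMonoidal._⊙_ A x y) (MVMonoidal.𝟘 A)
theoremC4 A si x y =
  swap (map collapse-x⊙y collapse-x⊕y
            (disjoint⇒trivial si (Θ₀ A (x ⊙ y)) (Θ₁ A (x ⊕ y)) (Θ₀[x⊙y]-Θ₁[x⊕y]-disjoint x y)))
  where
  open MVMonoidal A
  open Separation A

  collapse-x⊙y : IsTrivial (Θ₀ A (x ⊙ y)) → x ⊙ y ≈ 𝟘
  collapse-x⊙y Θ₀-trivial = Θ₀-trivial _ _ (Θ₀-identifies-𝟘 A (x ⊙ y))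

  collapse-x⊕y : IsTrivial (Θ₁ A (x ⊕ y)) → x ⊕ y ≈ 𝟙
  collapse-x⊕y Θ₁-trivial = Θ₁-trivial _ _ (Θ₁-identifies-𝟙 A (x ⊕ y))
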